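{- Let $I$ be an instance of RMPV and $D_I$ its in-out graph. Then there is a directed $s$-$t$ path in $D_I$ if and only if $I$ is a yes-instance.
   Context: An instance $I=(A,C,U,k,\ell,x)$ of RMPV consists of agents $A$, candidates $C$, voting profiles $U=(u_1,\dots,u_\tau)$ with $u_t\colon A\to C\cup\{\emptyset\}$, and integers $k\in\mathbb{N}$, $\ell\in\mathbb{N}_0$, $x\in\mathbb{N}$; for $C'\subseteq C$ let $\mathrm{score}_t(C')=|u_t^{ -1}(C')|$; $I$ is a yes-instance iff there are committees $C_1,\dots,C_\tau\subseteq C$ with $|C_t|\le k$, $\mathrm{score}_t(C_t)\ge x$ for all $t$, and $|C_t\triangle C_{t+1}|\ge\ell$ for all $t\le\tau-1$. The in-out graph $D_I$ is the directed graph with vertex set $V^1\cup\dots\cup V^{\tau-1}\cup\{s,t\}$, where $V^i=\{v^i_{X,Y}\mid X,Y\subseteq C,\ |X|,|Y|\le\ell,\ X\cap Y=\emptyset,\ |X\cup Y|\ge \ell\}$, and with the following arcs: $(s,v^1_{X,Y})$ iff there is a committee of size at most $k$ at stage $1$ containing $X$, disjoint from $Y$, with score at least $x$; $(v^{\tau-1}_{X,Y},t)$ iff there is a committee of size at most $k$ at stage $\tau$ containing $Y$, disjoint from $X$, with score at least $x$; and $(v^i_{X,Y},v^j_{X',Y'})$ iff $j=i+1$, $X\cap X'=Y\cap Y'=\emptyset$, and there is a committee of size at most $k$ at stage $i+1$ containing $Y\cup X'$, disjoint from $X\cup Y'$, with score at least $x$. -}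

module Defs where

open import Data.Nat using (ℕ; zero; suc; _≤_; _<_)
open import Data.Fin using (Fin; toℕ; fromℕ<)
open import Data.Fin.Subset using (Subset; _∈_; _∉_; _⊆_; _∪_; _─_; ∣_∣)
open import Data.Maybe using (Maybe; maybe)
open import Data.Bool using (Bool; false)
open import Data.Vec using (lookup; tabulate)
open import Data.Product using (Σ; _×_)
open import Data.Empty using (⊥)
open import Relation.Binary.PropositionalEquality using (_≡_)

Disjoint : {n : ℕ} → Subset n → Subset n → Set
Disjoint X Y = ∀ c → c ∈ X → c ∉ Y

_△_ : {n : ℕ} → Subset n → Subset n → Subset n
X △ Y = (X ─ Y) ∪ (Y ─ X)

-- Agents are Fin nA, candidates Fin nC, and the
-- τ voting profiles are indexed 0-based by Fin τ (stage t of the paper is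
-- index t-1 here); nothing (∅) means the agent abstains.
record Instance : Set where
  field
    nA nC τ : ℕ
    u : Fin τ → Fin nA → Maybe (Fin nC)
    k ℓ x : ℕ

module _ (I : Instance) where
  open Instance I

  score : Fin τ → Subset nC → ℕ
  score t C' = ∣ tabulate (λ a → maybe (lookup C') false (u t a)) ∣

  Valid : Fin τ → Subset nC → Set
  Valid t C' = (∣ C' ∣ ≤ k) × (x ≤ score t C')

  YesInstance : Set
  YesInstance =
    Σ (Fin τ → Subset nC) λ Cs →
      (∀ t → Valid t (Cs t)) ×
      (∀ (i j : Fin τ) → toℕ j ≡ suc (toℕ i) → ℓ ≤ ∣ Cs i △ Cs j ∣)

  -- Vertices of the in-out graph D_I.  The vertex  v i p X Y  is the paper's
  -- v^{i+1}_{X,Y} (layers 0-based; p says layer i is one of the τ-1 layers,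
  -- i.e. i is not the last stage).
  data Vertex : Set where
    s t : Vertex
    v : (i : Fin τ) → suc (toℕ i) < τ → (X Y : Subset nC) →
        ∣ X ∣ ≤ ℓ → ∣ Y ∣ ≤ ℓ → Disjoint X Y → ℓ ≤ ∣ X ∪ Y ∣ → Vertex

  -- Arcs of D_I.  For layer i (0-based), fromℕ< p is the 0-based index of
  -- the stage following stage i, i.e. paper stage i+2 for paper layer i+1.
  Arc : Vertex → Vertex → Set
  Arc s (v i p X Y _ _ _ _) =
    (toℕ i ≡ 0) ×
    Σ (Subset nC) λ C' → Valid i C' × X ⊆ C' × Disjoint C' Y
  Arc (v i p X Y _ _ _ _) t =
    (suc (suc (toℕ i)) ≡ τ) ×
    Σ (Subset nC) λ C' → Valid (fromℕ< p) C' × Y ⊆ C' × Disjoint C' X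
  Arc (v i p X Y _ _ _ _) (v j q X' Y' _ _ _ _) =
    (toℕ j ≡ suc (toℕ i)) × Disjoint X X' × Disjoint Y Y' ×
    Σ (Subset nC) λ C' →
      Valid (fromℕ< p) C' × (Y ∪ X') ⊆ C' × Disjoint C' (X ∪ Y')
  Arc _ _ = ⊥

{-# OPTIONS --safe #-}
-- A vertex (X, Y) between stages i and i+1 says that the committee changes by dropping X and
-- adding Y, and an arc carries a committee for the stage it enters that agrees with the change
-- on its left (contains Y, avoids X) and with the change on its right (contains X′, avoids Y′).
-- Along an s–t path consecutive committees therefore differ on all of X ∪ Y, which has at least
-- ℓ elements.  Conversely, given committees, pick ℓ elements of each C_i △ C_{i+1} and split
-- them into X ⊆ C_i and Y ⊆ C_{i+1}.
module Submission where

open import Defs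
open import Data.Nat using (_≤_)
open import Function.Bundles using (_⇔_)
open import Relation.Binary.Construct.Closure.ReflexiveTransitive using (Star)

open import Data.Empty using (⊥-elim)
open import Data.Fin using (Fin; toℕ; fromℕ<)
open import Data.Fin.Properties using (toℕ-fromℕ<; toℕ-injective; toℕ<n)
open import Data.Fin.Subset
  using (Subset; _∈_; _∉_; _⊆_; _∪_; _∩_; _─_; ∣_∣; inside; outside)
  renaming (⊥ to ∅)
open import Data.Fin.Subset.Properties
  using (p⊆q⇒∣p∣≤∣q∣; x∈p∪q⁻; x∈p∪q⁺; p⊆p∪q; q⊆p∪q; x∈p∩q⁺; x∈p∩q⁻;
         ∣p∩q∣≤∣p∣; x∈p∧x∉q⇒x∈p─q; p─q⊆p; ⊆-min; ∣⊥∣≡0; out⊆; s⊆s)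
open import Data.Nat using (ℕ; zero; suc; _<_; _+_; _∸_; s≤s; z≤n)
open import Data.Nat.Properties
  using (≤-trans; ≤-reflexive; <⇒≱; <-irrefl; <-trans; n≤1+n; m≤m+n; m≤n+m;
         +-suc; +-identityʳ; m∸n+n≡m)
open import Data.Product using (Σ-syntax; _×_; _,_; proj₁; proj₂)
open import Data.Sum using (inj₁; inj₂; [_,_]′)
open import Data.Vec using (_∷_)
open import Data.Vec.Base using (here; there)
open import Function.Bundles using (mk⇔; Equivalence)
open import Relation.Binary.Construct.Closure.ReflexiveTransitive using (ε; _◅_)
open import Relation.Binary.PropositionalEquality
  using (_≡_; refl; sym; trans; cong; subst)

open Equivalence using (to; from)

x∈p─q⇒x∉q : ∀ {n} (p q : Subset n) {x} → x ∈ p ─ q → x ∉ q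
x∈p─q⇒x∉q (_ ∷ p) (inside  ∷ q) ()        here
x∈p─q⇒x∉q (_ ∷ p) (outside ∷ q) here      ()
x∈p─q⇒x∉q (_ ∷ p) (_       ∷ q) (there m) (there m′) = x∈p─q⇒x∉q p q m m′

subsetOfSize : ∀ {n} m (S : Subset n) → m ≤ ∣ S ∣ → Σ[ T ∈ Subset n ] T ⊆ S × ∣ T ∣ ≡ m
subsetOfSize {n} zero    S             _ = ∅ , ⊆-min S , ∣⊥∣≡0 n
subsetOfSize (suc m)     (outside ∷ S) le with subsetOfSize (suc m) S le
... | T , T⊆S , ∣T∣≡ = outside ∷ T , out⊆ T⊆S , ∣T∣≡
subsetOfSize (suc m)     (inside ∷ S)  (s≤s le) with subsetOfSize m S le
... | T , T⊆S , ∣T∣≡ = inside ∷ T , s⊆s T⊆S , cong suc ∣T∣≡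

module _ {n : ℕ} where

  Before After : Subset n → Subset n → Subset n → Set
  Before X Y C = X ⊆ C × Disjoint C Y
  After  X Y D = Y ⊆ D × Disjoint D X

  after⇒disjoint : ∀ {X Y D} → After X Y D → Disjoint X Y
  after⇒disjoint (Y⊆D , D∩X) c c∈X c∈Y = D∩X c (Y⊆D c∈Y) c∈X

  ∪⊆△ : ∀ {X Y C D} → Before X Y C → After X Y D → X ∪ Y ⊆ C △ D
  ∪⊆△ {X} {Y} (X⊆C , C∩Y) (Y⊆D , D∩X) {c} c∈X∪Y with x∈p∪q⁻ X Y c∈X∪Y
  ... | inj₁ c∈X = x∈p∪q⁺ (inj₁ (x∈p∧x∉q⇒x∈p─q (X⊆C c∈X) (λ c∈D → D∩X c c∈D c∈X)))
  ... | inj₂ c∈Y = x∈p∪q⁺ (inj₂ (x∈p∧x∉q⇒x∈p─q (Y⊆D c∈Y) (λ c∈C → C∩Y c c∈C c∈Y)))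

  ∣∪∣≤∣△∣ : ∀ {X Y} C D → Before X Y C → After X Y D → ∣ X ∪ Y ∣ ≤ ∣ C △ D ∣
  ∣∪∣≤∣△∣ _ _ before after = p⊆q⇒∣p∣≤∣q∣ (∪⊆△ before after)

  after×before⇔ : ∀ {X Y X′ Y′ C} →
                  (After X Y C × Before X′ Y′ C) ⇔ ((Y ∪ X′) ⊆ C × Disjoint C (X ∪ Y′))
  after×before⇔ {X} {Y} {X′} {Y′} = mk⇔
    (λ ((Y⊆C , C∩X) , (X′⊆C , C∩Y′)) →
       (λ m → [ Y⊆C , X′⊆C ]′ (x∈p∪q⁻ Y X′ m)) ,
       (λ c c∈C m → [ C∩X c c∈C , C∩Y′ c c∈C ]′ (x∈p∪q⁻ X Y′ m)))
    (λ (⊆C , C∩) →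
       ((λ m → ⊆C (p⊆p∪q X′ m)) , (λ c c∈C m → C∩ c c∈C (p⊆p∪q Y′ m))) ,
       ((λ m → ⊆C (q⊆p∪q Y X′ m)) , (λ c c∈C m → C∩ c c∈C (q⊆p∪q X Y′ m))))

  after-before⇒disjoint : ∀ {X Y X′ Y′ C} → After X Y C → Before X′ Y′ C →
                          Disjoint X X′ × Disjoint Y Y′
  after-before⇒disjoint (Y⊆C , C∩X) (X′⊆C , C∩Y′) =
    (λ c c∈X c∈X′ → C∩X c (X′⊆C c∈X′) c∈X) , (λ c c∈Y → C∩Y′ c (Y⊆C c∈Y))

  record Swap (ℓ : ℕ) (C D : Subset n) : Set where
    field
      removed added       : Subset n
      ∣removed∣≤ℓ         : ∣ removed ∣ ≤ ℓ
      ∣added∣≤ℓ           : ∣ added ∣ ≤ ℓ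
      ℓ≤∣removed∪added∣   : ℓ ≤ ∣ removed ∪ added ∣
      before              : Before removed added C
      after               : After removed added D

  swap : ∀ ℓ (C D : Subset n) → ℓ ≤ ∣ C △ D ∣ → Swap ℓ C D
  swap ℓ C D ℓ≤ with subsetOfSize ℓ (C △ D) ℓ≤
  ... | T , T⊆ , ∣T∣≡ℓ = record
    { removed           = X
    ; added             = Y
    ; ∣removed∣≤ℓ       = ≤-trans (∣p∩q∣≤∣p∣ T (C ─ D)) (≤-reflexive ∣T∣≡ℓ)
    ; ∣added∣≤ℓ         = ≤-trans (∣p∩q∣≤∣p∣ T (D ─ C)) (≤-reflexive ∣T∣≡ℓ)
    ; ℓ≤∣removed∪added∣ = ≤-trans (≤-reflexive (sym ∣T∣≡ℓ)) (p⊆q⇒∣p∣≤∣q∣ T⊆X∪Y)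
    ; before            = (λ m → p─q⊆p C D (in─ m)) , (λ c c∈C m → x∈p─q⇒x∉q D C (in─ m) c∈C)
    ; after             = (λ m → p─q⊆p D C (in─ m)) , (λ c c∈D m → x∈p─q⇒x∉q C D (in─ m) c∈D)
    }
    where
    X = T ∩ (C ─ D)
    Y = T ∩ (D ─ C)
    in─ : ∀ {A c} → c ∈ T ∩ A → c ∈ A
    in─ {A} m = proj₂ (x∈p∩q⁻ T A m)
    T⊆X∪Y : T ⊆ X ∪ Y
    T⊆X∪Y c∈T with x∈p∪q⁻ (C ─ D) (D ─ C) (T⊆ c∈T)
    ... | inj₁ c∈C─D = x∈p∪q⁺ (inj₁ (x∈p∩q⁺ (c∈T , c∈C─D)))
    ... | inj₂ c∈D─C = x∈p∪q⁺ (inj₂ (x∈p∩q⁺ (c∈T , c∈D─C)))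

module _ (I : Instance) where
  open Instance I

  ValidAt : ℕ → Subset nC → Set
  ValidAt m C = ∀ j → toℕ j ≡ m → Valid I j C

  valid⇒validAt : ∀ {j} C → Valid I j C → ValidAt (toℕ j) C
  valid⇒validAt C validC j e = subst (λ i → Valid I i C) (sym (toℕ-injective e)) validC

  validAt-next : ∀ {i : Fin τ} C (p : suc (toℕ i) < τ) →
                 Valid I (fromℕ< p) C → ValidAt (suc (toℕ i)) C
  validAt-next C p validC = subst (λ m → ValidAt m C) (toℕ-fromℕ< p) (valid⇒validAt C validC)

  -- committee n is the committee of stage m + n; ValidAt is vacuous past the last stage.
  record Schedule (m : ℕ) : Set where
    field
      committee : ℕ → Subset nC
      valid     : ∀ n → ValidAt (m + n) (committee n)
      far       : ∀ n → suc (m + n) < τ → ℓ ≤ ∣ committee n △ committee (suc n) ∣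

  open Schedule

  emptySchedule : ∀ {m} → τ ≤ m → Schedule m
  emptySchedule {m} τ≤m = record
    { committee = λ _ → ∅
    ; valid     = λ n j e →
        ⊥-elim (<⇒≱ (toℕ<n j) (≤-trans τ≤m (≤-trans (m≤m+n m n) (≤-reflexive (sym e)))))
    ; far       = λ n lt → ⊥-elim (<⇒≱ lt (≤-trans τ≤m (≤-trans (m≤m+n m n) (n≤1+n (m + n)))))
    }

  prepend : ∀ {m} C → ValidAt m C → (G : Schedule (suc m)) →
            (suc m < τ → ℓ ≤ ∣ C △ committee G 0 ∣) → Schedule m
  prepend {m} C validC G far₀ = record { committee = committee′ ; valid = valid′ ; far = far′ }
    where
    committee′ : ℕ → Subset nC
    committee′ zero    = C
    committee′ (suc n) = committee G n
    valid′ : ∀ n → ValidAt (m + n) (committee′ n)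
    valid′ zero    = subst (λ k → ValidAt k C) (sym (+-identityʳ m)) validC
    valid′ (suc n) = subst (λ k → ValidAt k (committee G n)) (sym (+-suc m n)) (valid G n)
    far′ : ∀ n → suc (m + n) < τ → ℓ ≤ ∣ committee′ n △ committee′ (suc n) ∣
    far′ zero    lt = far₀ (subst (λ k → suc k < τ) (+-identityʳ m) lt)
    far′ (suc n) lt = far G n (subst (λ k → suc k < τ) (+-suc m n) lt)

  schedule⇒yes : Schedule 0 → YesInstance I
  schedule⇒yes G =
    (λ j → committee G (toℕ j)) ,
    (λ j → valid G (toℕ j) j refl) ,
    (λ i j e → subst (λ k → ℓ ≤ ∣ committee G (toℕ i) △ committee G k ∣) (sym e)
                     (far G (toℕ i) (subst (_< τ) e (toℕ<n j))))

  ScheduleAfter : ℕ → Subset nC → Subset nC → Set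
  ScheduleAfter m X Y = Σ[ G ∈ Schedule m ] After X Y (committee G 0)

  -- The committee carried by each arc becomes the committee of the stage the arc enters.
  path⇒scheduleAfter : ∀ {i p X Y a b c d} →
                       Star (Arc I) (v i p X Y a b c d) t → ScheduleAfter (suc (toℕ i)) X Y
  path⇒scheduleAfter {p = p} (_◅_ {j = t} (last , C , validC , afterC) ε) =
    prepend C (validAt-next C p validC) (emptySchedule (≤-reflexive (sym last)))
            (λ lt → ⊥-elim (<-irrefl last lt)) ,
    afterC
  path⇒scheduleAfter (_◅_ {j = t} _ (() ◅ _))
  path⇒scheduleAfter (_◅_ {j = s} () _)
  path⇒scheduleAfter {i} {p} {X} {Y}
    (_◅_ {j = v j q X′ Y′ _ _ _ ℓ≤∣X′∪Y′∣} (next , _ , _ , C , validC , ⊆C×C∩) rest) =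
    prepend C (validAt-next C p validC) G
            (λ _ → ≤-trans ℓ≤∣X′∪Y′∣ (∣∪∣≤∣△∣ C (committee G 0) beforeC afterG)) ,
    afterC
    where
    afterC×beforeC : After X Y C × Before X′ Y′ C
    afterC×beforeC = from after×before⇔ ⊆C×C∩
    afterC = proj₁ afterC×beforeC
    beforeC = proj₂ afterC×beforeC
    G,afterG : ScheduleAfter (suc (suc (toℕ i))) X′ Y′
    G,afterG = subst (λ m → ScheduleAfter (suc m) X′ Y′) next (path⇒scheduleAfter rest)
    G = proj₁ G,afterG
    afterG = proj₂ G,afterG

  path⇒yes : Star (Arc I) s t → YesInstance I
  path⇒yes (_◅_ {j = s} () _)
  path⇒yes (_◅_ {j = t} () _)
  path⇒yes (_◅_ {j = v i p X Y _ _ _ ℓ≤∣X∪Y∣} (first , C , validC , beforeC) rest) =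
    schedule⇒yes (prepend C (subst (λ m → ValidAt m C) first (valid⇒validAt C validC)) G
                          (λ _ → ≤-trans ℓ≤∣X∪Y∣ (∣∪∣≤∣△∣ C (committee G 0) beforeC afterG)))
    where
    G,afterG : ScheduleAfter 1 X Y
    G,afterG = subst (λ m → ScheduleAfter (suc m) X Y) first (path⇒scheduleAfter rest)
    G = proj₁ G,afterG
    afterG = proj₂ G,afterG

  module _ (Cs : Fin τ → Subset nC) (validCs : ∀ j → Valid I j (Cs j))
           (farCs : ∀ (i j : Fin τ) → toℕ j ≡ suc (toℕ i) → ℓ ≤ ∣ Cs i △ Cs j ∣) where

    swapAt : (i : Fin τ) (p : suc (toℕ i) < τ) → Swap ℓ (Cs i) (Cs (fromℕ< p))
    swapAt i p = swap ℓ (Cs i) (Cs (fromℕ< p)) (farCs i (fromℕ< p) (toℕ-fromℕ< p))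

    vertexAt : (i : Fin τ) → suc (toℕ i) < τ → Vertex I
    vertexAt i p =
      v i p removed added ∣removed∣≤ℓ ∣added∣≤ℓ (after⇒disjoint after) ℓ≤∣removed∪added∣
      where open Swap (swapAt i p)

    arcAt : (i : Fin τ) (p : suc (toℕ i) < τ) (q : suc (toℕ (fromℕ< p)) < τ) →
            Arc I (vertexAt i p) (vertexAt (fromℕ< p) q)
    arcAt i p q =
      toℕ-fromℕ< p ,
      proj₁ disjoint , proj₂ disjoint ,
      Cs j , validCs j , to after×before⇔ (Swap.after (swapAt i p) , Swap.before (swapAt j q))
      where
      j = fromℕ< p
      disjoint = after-before⇒disjoint (Swap.after (swapAt i p)) (Swap.before (swapAt j q))

    pathFrom : ∀ d (i : Fin τ) (p : suc (toℕ i) < τ) → d + suc (suc (toℕ i)) ≡ τ →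
               Star (Arc I) (vertexAt i p) t
    pathFrom zero i p last =
      (last , Cs (fromℕ< p) , validCs (fromℕ< p) , Swap.after (swapAt i p)) ◅ ε
    pathFrom (suc d) i p d+2+i≡τ = arcAt i p q ◅ pathFrom d j q d+2+j≡τ
      where
      j = fromℕ< p
      d+2+j≡τ : d + suc (suc (toℕ j)) ≡ τ
      d+2+j≡τ = trans (cong (λ k → d + suc (suc k)) (toℕ-fromℕ< p)) (trans (+-suc d _) d+2+i≡τ)
      q : suc (toℕ j) < τ
      q = subst (suc (toℕ j) <_) d+2+j≡τ (m≤n+m _ d)

    yes⇒path : 2 ≤ τ → Star (Arc I) s t
    yes⇒path 2≤τ =
      (first , Cs i , validCs i , Swap.before (swapAt i p)) ◅ pathFrom (τ ∸ 2) i p d+2+i≡τ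
      where
      0<τ : 0 < τ
      0<τ = <-trans (s≤s z≤n) 2≤τ
      i = fromℕ< 0<τ
      first : toℕ i ≡ 0
      first = toℕ-fromℕ< 0<τ
      p : suc (toℕ i) < τ
      p = subst (λ k → suc k < τ) (sym first) 2≤τ
      d+2+i≡τ : τ ∸ 2 + suc (suc (toℕ i)) ≡ τ
      d+2+i≡τ = trans (cong (λ k → τ ∸ 2 + suc (suc k)) first) (m∸n+n≡m 2≤τ)

lemma12 : (I : Instance) → 1 ≤ Instance.k I → 1 ≤ Instance.x I →
          2 ≤ Instance.τ I →
          Star (Arc I) (s {I}) (t {I}) ⇔ YesInstance I
lemma12 I _ _ 2≤τ = mk⇔ (path⇒yes I) (λ (Cs , validCs , farCs) → yes⇒path I Cs validCs farCs 2≤τ)
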